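{- Let $G$ be a finite abelian group of order $v$, and let $m\ge 2$, $k\ge 1$ and $\lambda\ge 1$ be integers. Suppose there exists a $(v,m,k,\lambda)$-SEDF in $G$ and $\gcd(k,v-1)=1$. Then the SEDF is trivial, i.e. $k=1$.
   Context: Groups are finite abelian, written multiplicatively with identity $1$. For a subset $A\subseteq G$ we also write $A$ for the group ring element $\sum_{a\in A}a\in\mathbb{Z}[G]$ and $A^{(-1)}=\sum_{a\in A}a^{ -1}$. Given integers $m\ge 2$, $k\ge1$, $\lambda\ge 1$ and a group $G$ of order $v$, a collection $\{D_1,\dots,D_m\}$ of mutually disjoint $k$-subsets of $G$ is a $(v,m,k,\lambda)$-strong external difference family (SEDF) in $G$ if $D_j\sum_{1\le i\le m,\, i\ne j}D_i^{(-1)}=\lambda(G-1)$ in $\mathbb{Z}[G]$ for each $j$ with $1\le j\le m$. The SEDF is trivial if $k=1$ and nontrivial if $k>1$. -}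

module Defs where

open import Data.Nat using (ℕ; zero; suc; _+_)
open import Data.Fin using (Fin; zero; suc; _≟_)
open import Data.Fin.Subset using (Subset; _∈_; ∣_∣; _∩_; ⊥)
open import Data.Fin.Subset.Properties using (_∈?_)
open import Data.Bool using (if_then_else_)
open import Data.Product using (_×_)
open import Relation.Nullary using (¬_; Dec; yes; no)
open import Relation.Nullary.Decidable using (⌊_⌋)
open import Relation.Binary.PropositionalEquality using (_≡_)
open import Algebra.Structures using (IsAbelianGroup)

∑ : (n : ℕ) → (Fin n → ℕ) → ℕ
∑ zero    f = 0
∑ (suc n) f = f zero + ∑ n (λ i → f (suc i))

[_] : {P : Set} → Dec P → ℕ
[ yes _ ] = 1
[ no  _ ] = 0

-- A finite abelian group of order v, presented (up to isomorphism) on the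
-- carrier Fin v with propositional equality.
record FinAbGroup (v : ℕ) : Set where
  field
    _∙_ : Fin v → Fin v → Fin v
    ε   : Fin v
    _⁻¹ : Fin v → Fin v
    isAbelianGroup : IsAbelianGroup _≡_ _∙_ ε _⁻¹

module _ {v : ℕ} (G : FinAbGroup v) where
  open FinAbGroup G

  -- Coefficient of g in the group ring element  D_j · Σ_{i ≠ j} D_i^{(-1)}:
  -- the number of triples (i , a , b) with i ≠ j, a ∈ D_j, b ∈ D_i, a b⁻¹ = g.
  extCoeff : {m : ℕ} → (Fin m → Subset v) → Fin m → Fin v → ℕ
  extCoeff {m} D j g =
    ∑ m (λ i → if ⌊ i ≟ j ⌋ then 0 else
      ∑ v (λ a → ∑ v (λ b →
        [ a ∈? D j ] * [ b ∈? D i ] * [ (a ∙ (b ⁻¹)) ≟ g ])))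
    where
      open import Data.Nat using (_*_)

  -- Coefficient of g in λ(G − 1).
  rhsCoeff : ℕ → Fin v → ℕ
  rhsCoeff λ' g = if ⌊ g ≟ ε ⌋ then 0 else λ'

  record IsSEDF (m k λ' : ℕ) (D : Fin m → Subset v) : Set where
    field
      size     : ∀ i → ∣ D i ∣ ≡ k
      disjoint : ∀ i j → ¬ (i ≡ j) → D i ∩ D j ≡ ⊥
      equation : ∀ j g → extCoeff D j g ≡ rhsCoeff λ' g

-- Counting the coefficients of both sides of the SEDF equation gives
-- (m − 1) k² = (v − 1) λ.  Since k is coprime to v − 1, k² divides λ, so
-- λ ≥ k² and hence v − 1 ≤ m − 1.  The m disjoint k-sets D_i fit into G,
-- so m k ≤ v ≤ m, forcing k = 1.
module Submission where

open import Defs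
open import Data.Nat using (ℕ; zero; suc; _+_; _*_; _∸_; _≤_; _<_; s≤s; z≤n; NonZero; >-nonZero)
open import Data.Nat.Properties
  using ( +-comm; +-assoc; +-mono-≤; +-commutativeSemigroup; *-assoc; *-identityˡ; *-identityʳ; *-zeroʳ
        ; *-distribˡ-+; *-distribʳ-+; *-distribʳ-∸; *-monoʳ-≤; *-cancelˡ-≤; *-cancelʳ-≤; m*n≢0
        ; m+n∸n≡m; m≤n+m∸n; ≤-reflexive; ≤-trans; ≤-antisym; module ≤-Reasoning )
open import Data.Nat.Divisibility using (_∣_; divides; ∣⇒≤; m*n∣⇒m∣; *-cancelʳ-∣; *-monoˡ-∣)
open import Data.Nat.Coprimality using (Coprime; coprime-divisor; gcd≡1⇒coprime)
open import Data.Nat.GCD using (gcd)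
open import Data.Fin using (Fin; zero; suc; _≟_)
open import Data.Fin.Properties using (suc-injective; 0≢1+n)
open import Data.Fin.Subset using (Subset; _∈_; ∣_∣; inside; outside)
open import Data.Fin.Subset.Properties using (_∈?_; ∉⊥; x∈p∩q⁺; drop-there)
open import Data.Vec using ([]; _∷_; there)
open import Data.Bool using (Bool; true; false; if_then_else_)
open import Data.Product using (_,_)
open import Data.Empty using (⊥-elim)
open import Relation.Nullary using (¬_; Dec; yes; no)
open import Relation.Nullary.Decidable using (⌊_⌋; ⌊⌋-map′)
open import Relation.Binary.PropositionalEquality
  using (_≡_; refl; sym; trans; cong; cong₂; subst; module ≡-Reasoning)
open import Algebra.Properties.CommutativeSemigroup +-commutativeSemigroup using (interchange)

∑-cong : ∀ n {f g : Fin n → ℕ} → (∀ i → f i ≡ g i) → ∑ n f ≡ ∑ n g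
∑-cong zero    f≗g = refl
∑-cong (suc n) f≗g = cong₂ _+_ (f≗g zero) (∑-cong n (λ i → f≗g (suc i)))

∑-zero : ∀ n → ∑ n (λ _ → 0) ≡ 0
∑-zero zero    = refl
∑-zero (suc n) = ∑-zero n

∑-const : ∀ n c → ∑ n (λ _ → c) ≡ n * c
∑-const zero    c = refl
∑-const (suc n) c = cong (c +_) (∑-const n c)

∑-+ : ∀ n (f g : Fin n → ℕ) → ∑ n (λ i → f i + g i) ≡ ∑ n f + ∑ n g
∑-+ zero    f g = refl
∑-+ (suc n) f g = trans (cong (f zero + g zero +_) (∑-+ n _ _))
  (interchange (f zero) (g zero) (∑ n (λ i → f (suc i))) (∑ n (λ i → g (suc i))))

∑-*ˡ : ∀ n c (f : Fin n → ℕ) → ∑ n (λ i → c * f i) ≡ c * ∑ n f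
∑-*ˡ zero    c f = sym (*-zeroʳ c)
∑-*ˡ (suc n) c f = trans (cong (c * f zero +_) (∑-*ˡ n c _)) (sym (*-distribˡ-+ c (f zero) _))

∑-*ʳ : ∀ n c (f : Fin n → ℕ) → ∑ n (λ i → f i * c) ≡ ∑ n f * c
∑-*ʳ zero    c f = refl
∑-*ʳ (suc n) c f = trans (cong (f zero * c +_) (∑-*ʳ n c _)) (sym (*-distribʳ-+ c (f zero) _))

∑-swap : ∀ n p (f : Fin n → Fin p → ℕ) →
  ∑ n (λ i → ∑ p (λ j → f i j)) ≡ ∑ p (λ j → ∑ n (λ i → f i j))
∑-swap zero    p f = sym (∑-zero p)
∑-swap (suc n) p f =
  trans (cong (∑ p (f zero) +_) (∑-swap n p _)) (sym (∑-+ p _ _))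

∑-product : ∀ n p (f : Fin n → ℕ) (g : Fin p → ℕ) →
  ∑ n (λ a → ∑ p (λ b → f a * g b)) ≡ ∑ n f * ∑ p g
∑-product n p f g = trans (∑-cong n (λ a → ∑-*ˡ p (f a) g)) (∑-*ʳ n (∑ p g) f)

∑-mono : ∀ n {f g : Fin n → ℕ} → (∀ i → f i ≤ g i) → ∑ n f ≤ ∑ n g
∑-mono zero    f≤g = z≤n
∑-mono (suc n) f≤g = +-mono-≤ (f≤g zero) (∑-mono n (λ i → f≤g (suc i)))

∑-if : ∀ n (c : Bool) (f : Fin n → ℕ) →
  ∑ n (λ i → if c then 0 else f i) ≡ (if c then 0 else ∑ n f)
∑-if n true  f = ∑-zero n
∑-if n false f = refl

[]-cong : ∀ {P Q : Set} → (P → Q) → (Q → P) → (p? : Dec P) (q? : Dec Q) → [ p? ] ≡ [ q? ]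
[]-cong P→Q Q→P (yes p) (yes q) = refl
[]-cong P→Q Q→P (yes p) (no ¬q) = ⊥-elim (¬q (P→Q p))
[]-cong P→Q Q→P (no ¬p) (yes q) = ⊥-elim (¬p (Q→P q))
[]-cong P→Q Q→P (no ¬p) (no ¬q) = refl

∑[≟] : ∀ n (x : Fin n) → ∑ n (λ g → [ x ≟ g ]) ≡ 1
∑[≟] (suc n) zero    = cong suc (∑-zero n)
∑[≟] (suc n) (suc x) =
  trans (∑-cong n (λ g → []-cong suc-injective (cong suc) (suc x ≟ suc g) (x ≟ g))) (∑[≟] n x)

∑-fibres : ∀ n p (φ : Fin p → Fin n) (h : Fin p → ℕ) →
  ∑ n (λ g → ∑ p (λ a → h a * [ φ a ≟ g ])) ≡ ∑ p h
∑-fibres n p φ h = begin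
  ∑ n (λ g → ∑ p (λ a → h a * [ φ a ≟ g ])) ≡⟨ ∑-swap n p _ ⟩
  ∑ p (λ a → ∑ n (λ g → h a * [ φ a ≟ g ])) ≡⟨ ∑-cong p (λ a → ∑-*ˡ n (h a) _) ⟩
  ∑ p (λ a → h a * ∑ n (λ g → [ φ a ≟ g ])) ≡⟨ ∑-cong p (λ a → cong (h a *_) (∑[≟] n (φ a))) ⟩
  ∑ p (λ a → h a * 1)                       ≡⟨ ∑-cong p (λ a → *-identityʳ (h a)) ⟩
  ∑ p h                                     ∎
  where open ≡-Reasoning

∑-except : ∀ n (x : Fin n) (f : Fin n → ℕ) →
  ∑ n (λ i → if ⌊ i ≟ x ⌋ then 0 else f i) + f x ≡ ∑ n f
∑-except (suc n) zero    f = +-comm (∑ n (λ i → f (suc i))) (f zero)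
∑-except (suc n) (suc x) f = begin
  f zero + ∑ n (λ i → if ⌊ suc i ≟ suc x ⌋ then 0 else f (suc i)) + f (suc x)
    ≡⟨ +-assoc (f zero) _ _ ⟩
  f zero + (∑ n (λ i → if ⌊ suc i ≟ suc x ⌋ then 0 else f (suc i)) + f (suc x))
    ≡⟨ cong (λ s → f zero + (s + f (suc x))) (∑-cong n λ i →
         cong (if_then 0 else f (suc i)) (⌊⌋-map′ (cong suc) suc-injective (i ≟ x))) ⟩
  f zero + (∑ n (λ i → if ⌊ i ≟ x ⌋ then 0 else f (suc i)) + f (suc x))
    ≡⟨ cong (f zero +_) (∑-except n x (λ i → f (suc i))) ⟩
  f zero + ∑ n (λ i → f (suc i)) ∎
  where open ≡-Reasoning

∑-except-const : ∀ n (x : Fin n) c → ∑ n (λ i → if ⌊ i ≟ x ⌋ then 0 else c) ≡ (n ∸ 1) * c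
∑-except-const n x c = begin
  ∑ n (λ i → if ⌊ i ≟ x ⌋ then 0 else c)           ≡⟨ sym (m+n∸n≡m _ c) ⟩
  ∑ n (λ i → if ⌊ i ≟ x ⌋ then 0 else c) + c ∸ c   ≡⟨ cong (_∸ c) (∑-except n x (λ _ → c)) ⟩
  ∑ n (λ _ → c) ∸ c                                ≡⟨ cong₂ _∸_ (∑-const n c) (sym (*-identityˡ c)) ⟩
  n * c ∸ 1 * c                                    ≡⟨ sym (*-distribʳ-∸ c n 1) ⟩
  (n ∸ 1) * c                                      ∎
  where open ≡-Reasoning

[suc∈∷] : ∀ {n} s (D : Subset n) a → [ suc a ∈? s ∷ D ] ≡ [ a ∈? D ]
[suc∈∷] s D a = []-cong drop-there there (suc a ∈? s ∷ D) (a ∈? D)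

∑[∈] : ∀ n (D : Subset n) → ∑ n (λ a → [ a ∈? D ]) ≡ ∣ D ∣
∑[∈] zero    []            = refl
∑[∈] (suc n) (inside  ∷ D) = cong suc (trans (∑-cong n ([suc∈∷] inside D)) (∑[∈] n D))
∑[∈] (suc n) (outside ∷ D) = trans (∑-cong n ([suc∈∷] outside D)) (∑[∈] n D)

∑[]≡0 : ∀ n {P : Fin n → Set} (P? : ∀ i → Dec (P i)) → (∀ i → ¬ P i) → ∑ n (λ i → [ P? i ]) ≡ 0
∑[]≡0 zero    P? ¬P = refl
∑[]≡0 (suc n) P? ¬P with P? zero
... | yes p = ⊥-elim (¬P zero p)
... | no  _ = ∑[]≡0 n (λ i → P? (suc i)) (λ i → ¬P (suc i))

∑[]≤1 : ∀ n {P : Fin n → Set} (P? : ∀ i → Dec (P i)) →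
  (∀ i j → P i → P j → i ≡ j) → ∑ n (λ i → [ P? i ]) ≤ 1
∑[]≤1 zero    P? unique = z≤n
∑[]≤1 (suc n) P? unique with P? zero
... | yes p = ≤-reflexive (cong suc (∑[]≡0 n (λ i → P? (suc i)) (λ i q → 0≢1+n (unique zero (suc i) p q))))
... | no  _ = ∑[]≤1 n (λ i → P? (suc i)) (λ i j p q → suc-injective (unique (suc i) (suc j) p q))

coprime-square-divisor : ∀ {k n o} .{{_ : NonZero k}} → Coprime k n → k * k ∣ n * o → k * k ∣ o
coprime-square-divisor {k} {n} {o} k⊥n k²∣no with coprime-divisor k⊥n (m*n∣⇒m∣ k k k²∣no)
... | divides t refl = *-monoˡ-∣ k (coprime-divisor k⊥n (*-cancelʳ-∣ k k²∣ntk))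
  where
  k²∣ntk : k * k ∣ n * t * k
  k²∣ntk = subst (k * k ∣_) (sym (*-assoc n t k)) k²∣no

counting-coprime⇒≤1 : ∀ {m n k λ'} .{{_ : NonZero k}} → Coprime k n → 0 < λ' →
  m * (k * k) ≡ n * λ' → suc m * k ≤ suc n → k ≤ 1
counting-coprime⇒≤1 {m} {n} {k} {λ'} k⊥n λ'>0 m*k²≡n*λ' [1+m]*k≤1+n =
  *-cancelˡ-≤ (suc m) (begin
    suc m * k ≤⟨ [1+m]*k≤1+n ⟩
    suc n     ≤⟨ s≤s n≤m ⟩
    suc m     ≡⟨ sym (*-identityʳ (suc m)) ⟩
    suc m * 1 ∎)
  where
  open ≤-Reasoning
  k²≤λ' : k * k ≤ λ'
  k²≤λ' = ∣⇒≤ {{>-nonZero λ'>0}} (coprime-square-divisor k⊥n (divides m (sym m*k²≡n*λ')))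
  n≤m : n ≤ m
  n≤m = *-cancelʳ-≤ n m (k * k) {{m*n≢0 k k}} (begin
    n * (k * k) ≤⟨ *-monoʳ-≤ n k²≤λ' ⟩
    n * λ'      ≡⟨ sym m*k²≡n*λ' ⟩
    m * (k * k) ∎)

module SEDF {v : ℕ} (G : FinAbGroup v) {m k λ' : ℕ} (D : Fin m → Subset v) (S : IsSEDF G m k λ' D) where
  open FinAbGroup G
  open IsSEDF S

  ∑-differences : ∀ i j →
    ∑ v (λ g → ∑ v (λ a → ∑ v (λ b → [ a ∈? D j ] * [ b ∈? D i ] * [ a ∙ (b ⁻¹) ≟ g ]))) ≡ k * k
  ∑-differences i j = begin
    ∑ v (λ g → ∑ v (λ a → ∑ v (λ b → [ a ∈? D j ] * [ b ∈? D i ] * [ a ∙ (b ⁻¹) ≟ g ])))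
      ≡⟨ ∑-swap v v _ ⟩
    ∑ v (λ a → ∑ v (λ g → ∑ v (λ b → [ a ∈? D j ] * [ b ∈? D i ] * [ a ∙ (b ⁻¹) ≟ g ])))
      ≡⟨ ∑-cong v (λ a → ∑-fibres v v (λ b → a ∙ (b ⁻¹)) _) ⟩
    ∑ v (λ a → ∑ v (λ b → [ a ∈? D j ] * [ b ∈? D i ]))
      ≡⟨ ∑-product v v _ _ ⟩
    ∑ v (λ a → [ a ∈? D j ]) * ∑ v (λ b → [ b ∈? D i ])
      ≡⟨ cong₂ _*_ (trans (∑[∈] v (D j)) (size j)) (trans (∑[∈] v (D i)) (size i)) ⟩
    k * k ∎
    where open ≡-Reasoning

  ∑-extCoeff : ∀ j → ∑ v (extCoeff G D j) ≡ (m ∸ 1) * (k * k)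
  ∑-extCoeff j = begin
    ∑ v (extCoeff G D j)
      ≡⟨ ∑-swap v m _ ⟩
    ∑ m (λ i → ∑ v (λ g → if ⌊ i ≟ j ⌋ then 0 else
      ∑ v (λ a → ∑ v (λ b → [ a ∈? D j ] * [ b ∈? D i ] * [ a ∙ (b ⁻¹) ≟ g ]))))
      ≡⟨ ∑-cong m (λ i → trans (∑-if v ⌊ i ≟ j ⌋ _) (cong (if ⌊ i ≟ j ⌋ then 0 else_) (∑-differences i j))) ⟩
    ∑ m (λ i → if ⌊ i ≟ j ⌋ then 0 else k * k)
      ≡⟨ ∑-except-const m j (k * k) ⟩
    (m ∸ 1) * (k * k) ∎
    where open ≡-Reasoning

  ∑-rhsCoeff : ∑ v (rhsCoeff G λ') ≡ (v ∸ 1) * λ'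
  ∑-rhsCoeff = ∑-except-const v ε λ'

  counting : Fin m → (m ∸ 1) * (k * k) ≡ (v ∸ 1) * λ'
  counting j = begin
    (m ∸ 1) * (k * k)    ≡⟨ sym (∑-extCoeff j) ⟩
    ∑ v (extCoeff G D j) ≡⟨ ∑-cong v (equation j) ⟩
    ∑ v (rhsCoeff G λ')  ≡⟨ ∑-rhsCoeff ⟩
    (v ∸ 1) * λ'         ∎
    where open ≡-Reasoning

  ∈-unique : ∀ x i j → x ∈ D i → x ∈ D j → i ≡ j
  ∈-unique x i j x∈Di x∈Dj with i ≟ j
  ... | yes i≡j = i≡j
  ... | no  i≢j = ⊥-elim (∉⊥ (subst (x ∈_) (disjoint i j i≢j) (x∈p∩q⁺ (x∈Di , x∈Dj))))

  m*k≤v : m * k ≤ v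
  m*k≤v = begin
    m * k                                    ≡⟨ sym (∑-const m k) ⟩
    ∑ m (λ _ → k)                            ≡⟨ ∑-cong m (λ i → sym (trans (∑[∈] v (D i)) (size i))) ⟩
    ∑ m (λ i → ∑ v (λ x → [ x ∈? D i ]))     ≡⟨ ∑-swap m v _ ⟩
    ∑ v (λ x → ∑ m (λ i → [ x ∈? D i ]))     ≤⟨ ∑-mono v (λ x → ∑[]≤1 m (λ i → x ∈? D i) (∈-unique x)) ⟩
    ∑ v (λ _ → 1)                            ≡⟨ ∑-const v 1 ⟩
    v * 1                                    ≡⟨ *-identityʳ v ⟩
    v                                        ∎
    where open ≤-Reasoning

lemma1p5 : (v : ℕ) (G : FinAbGroup v) (m k λ' : ℕ) →
    2 ≤ m → 1 ≤ k → 1 ≤ λ' →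
    (D : Fin m → Subset v) → IsSEDF G m k λ' D →
    gcd k (v ∸ 1) ≡ 1 →
    k ≡ 1
lemma1p5 v G (suc m) k λ' (s≤s _) 1≤k 1≤λ' D S gcd≡1 =
  ≤-antisym k≤1 1≤k
  where
  open SEDF G D S
  k≤1 : k ≤ 1
  k≤1 = counting-coprime⇒≤1 {m = m} {{>-nonZero 1≤k}} (gcd≡1⇒coprime gcd≡1) 1≤λ' (counting zero)
          (≤-trans m*k≤v (m≤n+m∸n v 1))
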